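{- Let $\mathbf{C}$ be a quasitopos with regular-mono partial map classifier $(T,\eta)$. For any regular monomorphism $t_L:L\to L'$, $t_L$ is a restricted classifier if and only if $[t_L,1_L]:L'\to T(L)$ is a monomorphism.
   Context: A quasitopos is a category with all finite limits and colimits that is locally cartesian closed and has a regular-subobject classifier. Its regular monos form a stable system of monics $\mathcal{M}$, and it has an $\mathcal{M}$-partial map classifier $(T,\eta)$: a functor $T$ and natural transformation $\eta:\mathrm{Id}\to T$ with each $\eta_X\in\mathcal{M}$ such that for every span $A\xleftarrow{m}X\xrightarrow{f}B$ with $m\in\mathcal{M}$ there is a unique $[m,f]:A\to T(B)$ making $\eta_B\circ f=[m,f]\circ m$ a pullback. A regular mono $t_L:L\to L'$ is a restricted classifier if there exists a monomorphism $s:L'\to T(L)$ with $s\circ t_L=\eta_L$. -}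

module Defs where

open import Level using (Level; _⊔_) renaming (suc to lsuc)
open import Relation.Binary using (Rel; IsEquivalence)
open import Data.Product using (Σ; _×_; _,_; proj₁; proj₂)

record Category (o ℓ e : Level) : Set (lsuc (o ⊔ ℓ ⊔ e)) where
  infixr 9 _∘_
  infix 4 _≈_
  infix 4 _⇒_
  field
    Obj : Set o
    _⇒_ : Obj → Obj → Set ℓ
    _≈_ : ∀ {A B} → Rel (A ⇒ B) e
    id : ∀ {A} → A ⇒ A
    _∘_ : ∀ {A B C} → B ⇒ C → A ⇒ B → A ⇒ C
    assoc : ∀ {A B C D} {f : A ⇒ B} {g : B ⇒ C} {h : C ⇒ D} →
            (h ∘ g) ∘ f ≈ h ∘ (g ∘ f)
    identityˡ : ∀ {A B} {f : A ⇒ B} → id ∘ f ≈ f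
    identityʳ : ∀ {A B} {f : A ⇒ B} → f ∘ id ≈ f
    equiv : ∀ {A B} → IsEquivalence (_≈_ {A} {B})
    ∘-resp-≈ : ∀ {A B C} {f h : B ⇒ C} {g i : A ⇒ B} →
               f ≈ h → g ≈ i → f ∘ g ≈ h ∘ i

module _ {o ℓ e : Level} (C : Category o ℓ e) where
  open Category C

  Mono : ∀ {A B} → A ⇒ B → Set (o ⊔ ℓ ⊔ e)
  Mono {A} f = ∀ {X} (g h : X ⇒ A) → f ∘ g ≈ f ∘ h → g ≈ h

  record IsPullback {P A B X : Obj} (p₁ : P ⇒ A) (p₂ : P ⇒ B)
                    (f : A ⇒ X) (g : B ⇒ X) : Set (o ⊔ ℓ ⊔ e) where
    field
      commute : f ∘ p₁ ≈ g ∘ p₂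
      universal : ∀ {Z} (h₁ : Z ⇒ A) (h₂ : Z ⇒ B) → f ∘ h₁ ≈ g ∘ h₂ →
        Σ (Z ⇒ P) λ u → (p₁ ∘ u ≈ h₁ × p₂ ∘ u ≈ h₂) ×
                        (∀ v → p₁ ∘ v ≈ h₁ → p₂ ∘ v ≈ h₂ → v ≈ u)

  record Pullback {A B X : Obj} (f : A ⇒ X) (g : B ⇒ X) : Set (o ⊔ ℓ ⊔ e) where
    field
      P : Obj
      p₁ : P ⇒ A
      p₂ : P ⇒ B
      isPullback : IsPullback p₁ p₂ f g

  record Pushout {X A B : Obj} (f : X ⇒ A) (g : X ⇒ B) : Set (o ⊔ ℓ ⊔ e) where
    field
      Q : Obj
      i₁ : A ⇒ Q
      i₂ : B ⇒ Q
      commute : i₁ ∘ f ≈ i₂ ∘ g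
      universal : ∀ {Z} (h₁ : A ⇒ Z) (h₂ : B ⇒ Z) → h₁ ∘ f ≈ h₂ ∘ g →
        Σ (Q ⇒ Z) λ u → (u ∘ i₁ ≈ h₁ × u ∘ i₂ ≈ h₂) ×
                        (∀ v → v ∘ i₁ ≈ h₁ → v ∘ i₂ ≈ h₂ → v ≈ u)

  record IsEqualizer {E A B : Obj} (m : E ⇒ A) (f g : A ⇒ B) : Set (o ⊔ ℓ ⊔ e) where
    field
      equality : f ∘ m ≈ g ∘ m
      universal : ∀ {Z} (h : Z ⇒ A) → f ∘ h ≈ g ∘ h →
        Σ (Z ⇒ E) λ u → m ∘ u ≈ h × (∀ v → m ∘ v ≈ h → v ≈ u)

  RegularMono : ∀ {E A} → E ⇒ A → Set (o ⊔ ℓ ⊔ e)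
  RegularMono {E} {A} m = Σ Obj λ B → Σ (A ⇒ B) λ f → Σ (A ⇒ B) λ g → IsEqualizer m f g

  IsTerminal : Obj → Set (o ⊔ ℓ ⊔ e)
  IsTerminal T = ∀ X → Σ (X ⇒ T) λ u → ∀ v → v ≈ u

  IsInitial : Obj → Set (o ⊔ ℓ ⊔ e)
  IsInitial I = ∀ X → Σ (I ⇒ X) λ u → ∀ v → v ≈ u

  shift : ∀ {Z E B X P} {e' : E ⇒ B} {u : Z ⇒ E} {z : Z ⇒ B} {p : X ⇒ B}
          {a : P ⇒ Z} {b : P ⇒ X} →
          e' ∘ u ≈ z → z ∘ a ≈ p ∘ b → e' ∘ (u ∘ a) ≈ p ∘ b
  shift {e' = e'} {u} {z} {a = a} eq sq =
    IsEquivalence.trans equiv (IsEquivalence.sym equiv (assoc {f = a} {g = u} {h = e'}))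
      (IsEquivalence.trans equiv (∘-resp-≈ eq (IsEquivalence.refl equiv {x = a})) sq)

  -- Exponential (q : Y → B)^(p : X → B) in the slice C/B, products in C/B
  -- being computed by the given choice of pullbacks.
  record SliceExponential
      (pb : ∀ {A B X} (f : A ⇒ X) (g : B ⇒ X) → Pullback f g)
      {B X Y : Obj} (p : X ⇒ B) (q : Y ⇒ B) : Set (o ⊔ ℓ ⊔ e) where
    field
      E : Obj
      π : E ⇒ B
      ev : Pullback.P (pb π p) ⇒ Y
      ev-over : q ∘ ev ≈ π ∘ Pullback.p₁ (pb π p)
    _×X : ∀ {Z} {z : Z ⇒ B} (u : Z ⇒ E) → π ∘ u ≈ z →
          Pullback.P (pb z p) ⇒ Pullback.P (pb π p)
    _×X {z = z} u eq = proj₁ (IsPullback.universal (Pullback.isPullback (pb π p))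
      (u ∘ Pullback.p₁ (pb z p)) (Pullback.p₂ (pb z p))
      (shift eq (IsPullback.commute (Pullback.isPullback (pb z p)))))
    field
      curry : ∀ {Z} (z : Z ⇒ B) (h : Pullback.P (pb z p) ⇒ Y) →
        q ∘ h ≈ z ∘ Pullback.p₁ (pb z p) →
        Σ (Z ⇒ E) λ u → Σ (π ∘ u ≈ z) λ eq → (ev ∘ (u ×X) eq ≈ h) ×
          (∀ v (eqv : π ∘ v ≈ z) → ev ∘ (v ×X) eqv ≈ h → v ≈ u)

  -- Quasitopos: finite limits (terminal + pullbacks), finite colimits
  -- (initial + pushouts), locally cartesian closed (every slice has
  -- exponentials), and a regular-subobject classifier.
  record Quasitopos : Set (o ⊔ ℓ ⊔ e) where
    field
      ⊤ : Obj
      ⊤-terminal : IsTerminal ⊤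
      pullback : ∀ {A B X} (f : A ⇒ X) (g : B ⇒ X) → Pullback f g
      ⊥ : Obj
      ⊥-initial : IsInitial ⊥
      pushout : ∀ {X A B} (f : X ⇒ A) (g : X ⇒ B) → Pushout f g
      sliceExp : ∀ {B X Y} (p : X ⇒ B) (q : Y ⇒ B) → SliceExponential pullback p q
      Ω : Obj
      true : ⊤ ⇒ Ω
      χ : ∀ {A X} (m : A ⇒ X) → RegularMono m →
        Σ (X ⇒ Ω) λ c → IsPullback m (proj₁ (⊤-terminal A)) c true ×
          (∀ c' → IsPullback m (proj₁ (⊤-terminal A)) c' true → c' ≈ c)

  record PartialMapClassifier : Set (o ⊔ ℓ ⊔ e) where
    field
      T₀ : Obj → Obj
      T₁ : ∀ {A B} → A ⇒ B → T₀ A ⇒ T₀ B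
      T-id : ∀ {A} → T₁ (id {A}) ≈ id
      T-∘ : ∀ {A B D} {f : A ⇒ B} {g : B ⇒ D} → T₁ (g ∘ f) ≈ T₁ g ∘ T₁ f
      T-resp-≈ : ∀ {A B} {f g : A ⇒ B} → f ≈ g → T₁ f ≈ T₁ g
      η : ∀ X → X ⇒ T₀ X
      η-natural : ∀ {A B} (f : A ⇒ B) → T₁ f ∘ η A ≈ η B ∘ f
      η-regular : ∀ X → RegularMono (η X)
      classify : ∀ {A X B} (m : X ⇒ A) (f : X ⇒ B) → RegularMono m →
        Σ (A ⇒ T₀ B) λ φ → IsPullback f m (η B) φ ×
          (∀ φ' → IsPullback f m (η B) φ' → φ' ≈ φ)

    [_,_]⟨_⟩ : ∀ {A X B} (m : X ⇒ A) (f : X ⇒ B) → RegularMono m → A ⇒ T₀ B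
    [ m , f ]⟨ r ⟩ = proj₁ (classify m f r)

    RestrictedClassifier : ∀ {L L'} → L ⇒ L' → Set (o ⊔ ℓ ⊔ e)
    RestrictedClassifier {L} {L'} t = Σ (L' ⇒ T₀ L) λ s → Mono s × s ∘ t ≈ η L

-- The classifying square of the span (t, 1) commutes as [t, 1] ∘ t ≈ η, so a
-- mono [t, 1] is itself a witness. Conversely, a mono s with s ∘ t ≈ η makes
-- the triangle (1, t, η, s) a pullback, since s ∘ t ∘ h₁ ≈ η ∘ h₁ ≈ s ∘ h₂
-- forces t ∘ h₁ ≈ h₂; so s classifies (t, 1) and equals [t, 1] by uniqueness.
module Submission where

open import Defs
open import Function.Bundles using (_⇔_; mk⇔)
open import Data.Product using (_,_; proj₁; proj₂)
open import Relation.Binary using (IsEquivalence)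

module _ {o ℓ e} (C : Category o ℓ e) where
  open Category C
  private module ≈ {A B} = IsEquivalence (equiv {A} {B})

  Mono-resp-≈ : ∀ {A B} {f g : A ⇒ B} → f ≈ g → Mono C f → Mono C g
  Mono-resp-≈ f≈g mono-f h k gh≈gk =
    mono-f h k (≈.trans (∘-resp-≈ f≈g ≈.refl)
               (≈.trans gh≈gk (≈.sym (∘-resp-≈ f≈g ≈.refl))))

  mono-triangle⇒isPullback : ∀ {A B X} {t : A ⇒ B} {g : A ⇒ X} {s : B ⇒ X} →
    Mono C s → s ∘ t ≈ g → IsPullback C id t g s
  mono-triangle⇒isPullback {t = t} {g} {s} mono-s st≈g = record
    { commute   = ≈.trans identityʳ (≈.sym st≈g)
    ; universal = λ h₁ h₂ sq →
        h₁ , (identityˡ , mono-s (t ∘ h₁) h₂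
                            (≈.trans (≈.sym assoc) (≈.trans (∘-resp-≈ st≈g ≈.refl) sq)))
           , λ v v≈h₁ _ → ≈.trans (≈.sym identityˡ) v≈h₁
    }

module _ {o ℓ e} {C : Category o ℓ e} (PMC : PartialMapClassifier C) where
  open Category C
  open PartialMapClassifier PMC
  private module ≈ {A B} = IsEquivalence (equiv {A} {B})

  classifier-triangle : ∀ {A X} (m : X ⇒ A) (m-reg : RegularMono C m) →
    [ m , id ]⟨ m-reg ⟩ ∘ m ≈ η X
  classifier-triangle m m-reg =
    ≈.trans (≈.sym (IsPullback.commute (proj₁ (proj₂ (classify m id m-reg))))) identityʳ

  mono-triangle⇒≈classifier : ∀ {A X} (m : X ⇒ A) (m-reg : RegularMono C m)
    {s : A ⇒ T₀ X} → Mono C s → s ∘ m ≈ η X → s ≈ [ m , id ]⟨ m-reg ⟩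
  mono-triangle⇒≈classifier m m-reg mono-s sm≈η =
    proj₂ (proj₂ (classify m id m-reg)) _ (mono-triangle⇒isPullback C mono-s sm≈η)

proposition7 : ∀ {o ℓ e} (C : Category o ℓ e) → Quasitopos C →
    (PMC : PartialMapClassifier C) →
    ∀ {L L'} (t : Category._⇒_ C L L') (t-reg : RegularMono C t) →
    PartialMapClassifier.RestrictedClassifier PMC t
    ⇔ Mono C (PartialMapClassifier.[_,_]⟨_⟩ PMC t (Category.id C) t-reg)
proposition7 C _ PMC t t-reg = mk⇔
  (λ { (s , mono-s , st≈η) →
         Mono-resp-≈ C (mono-triangle⇒≈classifier PMC t t-reg mono-s st≈η) mono-s })
  (λ mono-φ → _ , mono-φ , classifier-triangle PMC t t-reg)
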